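{- Let $q$ be a power of an odd prime, let $n\ge 3$ be an odd integer, and let $a,c\in\mathbb{F}_q$, not both zero. Let $f:\mathbb{F}_{q^2}\to\mathbb{F}_{q^2}$ be given by $f(X)=(cX^q+aX)(X^q-X)^{n-1}$, and put $\delta_2=a-c$. If $\delta_2=0$, then the functional graph of $f$ on $\mathbb{F}_{q^2}$ has exactly one connected component. Moreover, it consists of a cycle of length one (the fixed point $0$) with $2q-2$ other vertices directed to it, and among these $2q-2$ vertices, $q-1$ of them have exactly $q-1$ elements in their preimage.
   Context: The functional graph of a map $f:\mathbb{F}_{q^2}\to\mathbb{F}_{q^2}$ is the directed graph with vertex set $\mathbb{F}_{q^2}$ and an edge $x\to f(x)$ for each $x$; connected components are those of the underlying undirected graph. The preimage of $\alpha$ is $f^{ -1}(\alpha)=\{x: f(x)=\alpha\}$. A vertex $x$ is "directed to" $\alpha$ if $f(x)=\alpha$. -}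

module Defs where

open import Level using (0ℓ)
open import Algebra.Bundles using (CommutativeRing)
open import Data.Nat using (ℕ; zero; suc)
open import Data.Product using (_×_; ∃)
open import Data.List using (List; length; filter)
open import Data.List.Relation.Unary.Any using (Any)
open import Data.List.Relation.Unary.AllPairs using (AllPairs)
open import Relation.Nullary using (¬_; Dec)
open import Relation.Unary using (Pred)
import Relation.Unary as U
open import Relation.Binary using (Decidable)
open import Relation.Binary.PropositionalEquality using (_≡_)
open import Relation.Binary.Construct.Closure.Equivalence using (EqClosure)

record FiniteField (N : ℕ) : Set₁ where
  field
    commRing : CommutativeRing 0ℓ 0ℓ
  open CommutativeRing commRing public
  field
    _≟_      : Decidable _≈_
    0≉1      : ¬ (0# ≈ 1#)
    inverse  : ∀ x → ¬ (x ≈ 0#) → ∃ λ y → x * y ≈ 1#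
    elements : List Carrier
    complete : ∀ x → Any (x ≈_) elements
    distinct : AllPairs (λ x y → ¬ (x ≈ y)) elements
    size     : length elements ≡ N

  pow : Carrier → ℕ → Carrier
  pow x zero    = 1#
  pow x (suc m) = x * pow x m

  count : {P : Pred Carrier 0ℓ} → U.Decidable P → ℕ
  count P? = length (filter P? elements)

  iter : (Carrier → Carrier) → ℕ → Carrier → Carrier
  iter f zero    x = x
  iter f (suc m) x = f (iter f m x)

  -- two vertices lie in the same connected component of the functional
  -- graph of f (edges x → f x, taken undirected)
  SameComponent : (Carrier → Carrier) → Carrier → Carrier → Set
  SameComponent f = EqClosure (λ x y → f x ≈ y)

-- Let q = p ^ k and frob x = x ^ q. In characteristic p, frob is additive, and x ^ (q * q) = x,
-- so frob is an involution of 𝔽_{q²}. Put Tr x = frob x + x and Δ x = frob x - x: then Tr x lies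
-- in ker Δ = 𝔽_q, Δ x lies in ker Tr, and x = (Tr x - Δ x) / 2. Both kernels are root sets of
-- X ^ q ∓ X, hence of size at most q, and x ↦ (Tr x , Δ x) is a bijection onto their product,
-- so each has exactly q elements. As a = c, f x = a · Tr x · (Δ x) ^ (n - 1) with n - 1 even,
-- so f is fixed by frob: f maps into 𝔽_q = ker Δ and f ∘ f = 0. The zeros of f are
-- ker Δ ∪ ker Tr, and over y ∈ 𝔽_q ∖ {0} the map Δ is a bijection from f⁻¹(y) onto ker Tr ∖ {0}.

module Submission where

open import Defs
open import Level using (0ℓ)
open import Function using (_∘_; case_of_)
open import Data.Empty using (⊥; ⊥-elim)
open import Data.Unit using (⊤; tt)
open import Data.Product using (_×_; _,_; proj₁; proj₂; ∃)
open import Data.Product.Relation.Binary.Pointwise.NonDependent using (_×ₛ_)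
open import Data.Sum using (_⊎_; inj₁; inj₂)
open import Data.Maybe using (Maybe; just; nothing)
open import Relation.Nullary using (yes; no; ¬_)
open import Relation.Nullary.Decidable using (_×-dec_; _⊎-dec_; ¬?)
open import Relation.Unary using (Pred; Decidable)
open import Relation.Binary using (Setoid; _Respects_; _Preserves_⟶_)
open import Relation.Binary.PropositionalEquality as ≡ using (_≡_)
import Relation.Binary.Construct.Closure.Equivalence as EqClosure
open import Algebra.Bundles using (CommutativeRing)
open import Algebra.Solver.Ring.AlmostCommutativeRing
  using (_-Raw-AlmostCommutative⟶_; fromCommutativeRing)

open import Data.Nat as ℕ using (ℕ; zero; suc; _∸_; _^_; _%_; _/_; _≤_; _<_; s≤s; z≤n)
open import Data.Nat using () renaming (_≟_ to _≟ℕ_)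
import Data.Nat.Properties as ℕ
open import Data.Nat.DivMod using (m≡m%n+[m/n]*n)
open import Data.Nat.Divisibility using (_∣_; divides; ∣⇒≤)
open import Data.Nat.Primality using (Prime; euclidsLemma; prime⇒nonTrivial; ¬prime[0]; ¬prime[1])
open import Data.Nat.Combinatorics using (_C_; nCk+nC[k+1]≡[n+1]C[k+1]; nC1≡n; nCn≡1)
open import Data.Nat.Combinatorics.Specification using (k>n⇒nCk≡0)
open import Data.Nat.Tactic.RingSolver using (solve-∀)
open import Data.Integer as ℤ using (ℤ; -[1+_]; _⊖_; _◃_; sign; ∣_∣)
import Data.Integer.Properties as ℤ
open import Data.Sign as Sign using (Sign)
open import Data.Fin as Fin using (Fin)
import Data.Fin.Properties as Fin
open import Data.Vec using (Vec; []; _∷_)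
open import Data.List as List using (List; []; _∷_; map; length; filter; foldr; cartesianProduct)
import Data.List.Properties as List
open import Data.List.Relation.Unary.Any using (here; there)
open import Data.List.Relation.Unary.All as All using (All; []; _∷_)
import Data.List.Relation.Unary.All.Properties as All
open import Data.List.Relation.Unary.AllPairs using ([]; _∷_)

[1+k]*[1+n]C[1+k]≡[1+n]*nCk : ∀ n k → suc k ℕ.* (suc n C suc k) ≡ suc n ℕ.* (n C k)
[1+k]*[1+n]C[1+k]≡[1+n]*nCk zero zero = ≡.refl
[1+k]*[1+n]C[1+k]≡[1+n]*nCk zero (suc k)
  rewrite k>n⇒nCk≡0 {1} {suc (suc k)} (s≤s (s≤s z≤n)) | k>n⇒nCk≡0 {0} {suc k} (s≤s z≤n)
  = ℕ.*-zeroʳ (suc (suc k))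
[1+k]*[1+n]C[1+k]≡[1+n]*nCk (suc n) zero = begin
  suc (suc n) C 1 ℕ.+ 0 ≡⟨ ℕ.+-identityʳ _ ⟩
  suc (suc n) C 1       ≡⟨ nC1≡n (suc (suc n)) ⟩
  suc (suc n)           ≡⟨ ℕ.*-identityʳ _ ⟨
  suc (suc n) ℕ.* 1     ∎
  where open ≡.≡-Reasoning
[1+k]*[1+n]C[1+k]≡[1+n]*nCk (suc n) (suc k) = begin
  suc (suc k) ℕ.* (suc (suc n) C suc (suc k))
    ≡⟨ ≡.cong (suc (suc k) ℕ.*_) (nCk+nC[k+1]≡[n+1]C[k+1] (suc n) (suc k)) ⟨
  suc (suc k) ℕ.* (A ℕ.+ B)
    ≡⟨ regroup₁ k A B ⟩
  suc k ℕ.* A ℕ.+ A ℕ.+ suc (suc k) ℕ.* B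
    ≡⟨ ≡.cong₂ (λ u v → u ℕ.+ A ℕ.+ v) ([1+k]*[1+n]C[1+k]≡[1+n]*nCk n k) ([1+k]*[1+n]C[1+k]≡[1+n]*nCk n (suc k)) ⟩
  suc n ℕ.* (n C k) ℕ.+ A ℕ.+ suc n ℕ.* (n C suc k)
    ≡⟨ regroup₂ (suc n) (n C k) A (n C suc k) ⟩
  suc n ℕ.* (n C k ℕ.+ n C suc k) ℕ.+ A
    ≡⟨ ≡.cong (λ z → suc n ℕ.* z ℕ.+ A) (nCk+nC[k+1]≡[n+1]C[k+1] n k) ⟩
  suc n ℕ.* A ℕ.+ A
    ≡⟨ ℕ.+-comm (suc n ℕ.* A) A ⟩
  suc (suc n) ℕ.* A ∎
  where
  open ≡.≡-Reasoning
  A = suc n C suc k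
  B = suc n C suc (suc k)
  regroup₁ : ∀ k a b → suc (suc k) ℕ.* (a ℕ.+ b) ≡ suc k ℕ.* a ℕ.+ a ℕ.+ suc (suc k) ℕ.* b
  regroup₁ = solve-∀
  regroup₂ : ∀ m a b c → m ℕ.* a ℕ.+ b ℕ.+ m ℕ.* c ≡ m ℕ.* (a ℕ.+ c) ℕ.+ b
  regroup₂ = solve-∀

prime∣pCk : ∀ {p k} → Prime p → 0 < k → k < p → p ∣ p C k
prime∣pCk {suc n} {suc k} pr _ k<p
  with euclidsLemma (suc k) (suc n C suc k) pr
         (divides (n C k) (≡.trans ([1+k]*[1+n]C[1+k]≡[1+n]*nCk n k) (ℕ.*-comm (suc n) (n C k))))
... | inj₁ p∣k   = ⊥-elim (ℕ.<⇒≱ k<p (∣⇒≤ p∣k))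
... | inj₂ p∣pCk = p∣pCk

m*o≡n*n⇒m≡n : ∀ {m o n} → m ≤ n → o ≤ n → m ℕ.* o ≡ n ℕ.* n → m ≡ n
m*o≡n*n⇒m≡n {m} {o} {n} m≤n o≤n mo≡nn with ℕ.m≤n⇒m<n∨m≡n m≤n
... | inj₂ m≡n = m≡n
... | inj₁ m<n = ⊥-elim (ℕ.<-irrefl mo≡nn (ℕ.≤-<-trans (ℕ.*-monoʳ-≤ m o≤n) (ℕ.*-monoˡ-< n m<n)))
  where instance _ = ℕ.>-nonZero (ℕ.≤-<-trans z≤n m<n)

2≤m^n : ∀ {m n} → 2 ≤ m → 1 ≤ n → 2 ≤ m ^ n
2≤m^n {m} {suc n} 2≤m _ = ℕ.≤-trans 2≤m (ℕ.m≤m*n m (m ^ n))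
  where instance _ = ℕ.m^n≢0 m n {{ℕ.>-nonZero (ℕ.≤-trans (s≤s z≤n) 2≤m)}}

odd⇒n∸1≡[n/2]*2 : ∀ n → n % 2 ≡ 1 → n ∸ 1 ≡ n / 2 ℕ.* 2
odd⇒n∸1≡[n/2]*2 n n-odd = ≡.cong (_∸ 1) (≡.trans (m≡m%n+[m/n]*n n 2) (≡.cong (ℕ._+ n / 2 ℕ.* 2) n-odd))

[m∸1]+[m∸1]≡2m∸2 : ∀ m → (m ∸ 1) ℕ.+ (m ∸ 1) ≡ 2 ℕ.* m ∸ 2
[m∸1]+[m∸1]≡2m∸2 zero    = ≡.refl
[m∸1]+[m∸1]≡2m∸2 (suc m) =
  ≡.trans (≡.cong (m ℕ.+_) (≡.sym (ℕ.+-identityʳ m))) (≡.cong (_∸ 1) (≡.sym (ℕ.+-suc m (m ℕ.+ 0))))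

length-cartesianProduct : ∀ {a b} {A : Set a} {B : Set b} (xs : List A) (ys : List B) →
  length (cartesianProduct xs ys) ≡ length xs ℕ.* length ys
length-cartesianProduct []       ys = ≡.refl
length-cartesianProduct (x ∷ xs) ys = ≡.trans (List.length-++ (map (x ,_) ys))
  (≡.cong₂ ℕ._+_ (List.length-map (x ,_) ys) (length-cartesianProduct xs ys))

module UniqueLists {c ℓ} (S : Setoid c ℓ) where
  open Setoid S renaming (Carrier to A)
  open import Relation.Binary.Properties.Setoid S using (≉-respʳ)
  open import Data.List.Membership.Setoid S using (_∈_; _─_)
  open import Data.List.Relation.Unary.Unique.Setoid S using (Unique)
  open import Data.List.Relation.Binary.Subset.Setoid S using (_⊆_)
  open import Data.List.Relation.Binary.Permutation.Setoid S
    using (_↭_; ↭-refl; ↭-trans; ↭-sym; ↭-prep; prep; swap)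

  private variable
    x y : A
    xs ys : List A

  ∈-─⁺ : (i : x ∈ xs) → y ∈ xs → ¬ y ≈ x → y ∈ xs ─ i
  ∈-─⁺ (here x≈z)  (here y≈z)  y≉x = ⊥-elim (y≉x (trans y≈z (sym x≈z)))
  ∈-─⁺ (here _)    (there y∈)  _   = y∈
  ∈-─⁺ (there _)   (here y≈z)  _   = here y≈z
  ∈-─⁺ (there i)   (there y∈)  y≉x = there (∈-─⁺ i y∈ y≉x)

  ∈-─⁻ : (i : x ∈ xs) → y ∈ xs ─ i → y ∈ xs
  ∈-─⁻ (here _)  y∈          = there y∈
  ∈-─⁻ (there _) (here y≈z)  = here y≈z
  ∈-─⁻ (there i) (there y∈)  = there (∈-─⁻ i y∈)

  unique-─ : Unique xs → (i : x ∈ xs) → Unique (xs ─ i)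
  unique-─ (_ ∷ xs!)      (here _)  = xs!
  unique-─ (z∉xs ∷ xs!)   (there i) = All.─⁺ i z∉xs ∷ unique-─ xs! i

  unique-∈-─⇒≉ : Unique xs → (i : x ∈ xs) → y ∈ xs ─ i → ¬ y ≈ x
  unique-∈-─⇒≉ (z∉xs ∷ _) (here x≈z) y∈ y≈x =
    All.lookupₛ S ≉-respʳ z∉xs y∈ (trans (sym x≈z) (sym y≈x))
  unique-∈-─⇒≉ (z∉xs ∷ _) (there i) (here y≈z) y≈x =
    All.lookupₛ S ≉-respʳ z∉xs i (trans (sym y≈z) y≈x)
  unique-∈-─⇒≉ (_ ∷ xs!) (there i) (there y∈) = unique-∈-─⇒≉ xs! i y∈

  ↭-─ : (i : x ∈ xs) → xs ↭ x ∷ (xs ─ i)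
  ↭-─ (here x≈z)            = prep (sym x≈z) ↭-refl
  ↭-─ {xs = z ∷ _} (there i) = ↭-trans (↭-prep z (↭-─ i)) (swap refl refl ↭-refl)

  unique-⊆-⊇⇒↭ : Unique xs → Unique ys → xs ⊆ ys → ys ⊆ xs → xs ↭ ys
  unique-⊆-⊇⇒↭ {[]}    {[]}    _ _ _ _  = ↭-refl
  unique-⊆-⊇⇒↭ {[]}    {_ ∷ _} _ _ _ ys⊆ = case ys⊆ (here refl) of λ ()
  unique-⊆-⊇⇒↭ {x ∷ xs} {ys} (x∉xs ∷ xs!) ys! xs⊆ ys⊆ =
    ↭-trans (↭-prep x (unique-⊆-⊇⇒↭ xs! (unique-─ ys! i) xs⊆ys─i ys─i⊆xs)) (↭-sym (↭-─ i))
    where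
    i = xs⊆ (here refl)
    xs⊆ys─i : xs ⊆ ys ─ i
    xs⊆ys─i y∈xs = ∈-─⁺ i (xs⊆ (there y∈xs)) λ y≈x →
      All.lookupₛ S ≉-respʳ x∉xs y∈xs (sym y≈x)
    ys─i⊆xs : ys ─ i ⊆ xs
    ys─i⊆xs y∈ with ys⊆ (∈-─⁻ i y∈)
    ... | here y≈x  = ⊥-elim (unique-∈-─⇒≉ ys! i y∈ y≈x)
    ... | there y∈xs = y∈xs

module _ {a b ℓ₁ ℓ₂} (S : Setoid a ℓ₁) (T : Setoid b ℓ₂) where
  private
    module S = Setoid S
    module T = Setoid T
  open import Data.List.Membership.Setoid S using () renaming (_∈_ to _∈ₛ_)
  open import Data.List.Membership.Setoid T using () renaming (_∈_ to _∈ₜ_)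
  open import Data.List.Membership.Setoid.Properties using (∈-map⁺; ∈-map⁻; ∈-resp-≈)
  open import Data.List.Relation.Unary.Unique.Setoid using (Unique)
  open import Data.List.Relation.Binary.Permutation.Setoid T using (_↭_)
  open import Relation.Binary.Properties.Setoid S using (≉-respʳ)
  open UniqueLists T using (unique-⊆-⊇⇒↭)

  unique-map⁺ : ∀ {g : S.Carrier → T.Carrier} {xs} →
    (∀ {x y} → x ∈ₛ xs → y ∈ₛ xs → g x T.≈ g y → x S.≈ y) →
    Unique S xs → Unique T (map g xs)
  unique-map⁺ {xs = []}     _   []           = []
  unique-map⁺ {xs = z ∷ zs} inj (z∉zs ∷ zs!) =
    All.map⁺ (All.tabulateₛ S λ w∈zs gz≈gw →
      All.lookupₛ S ≉-respʳ z∉zs w∈zs (inj (here S.refl) (there w∈zs) gz≈gw))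
    ∷ unique-map⁺ (λ x∈ y∈ → inj (there x∈) (there y∈)) zs!

  map-↭ : ∀ {g : S.Carrier → T.Carrier} {xs ys} → g Preserves S._≈_ ⟶ T._≈_ →
    (∀ {x y} → x ∈ₛ xs → y ∈ₛ xs → g x T.≈ g y → x S.≈ y) →
    (∀ {x} → x ∈ₛ xs → g x ∈ₜ ys) →
    (∀ {y} → y ∈ₜ ys → ∃ λ x → x ∈ₛ xs × y T.≈ g x) →
    Unique S xs → Unique T ys → map g xs ↭ ys
  map-↭ g-cong inj into onto xs! ys! = unique-⊆-⊇⇒↭ (unique-map⁺ inj xs!) ys!
    (λ v∈ → let x , x∈ , v≈gx = ∈-map⁻ S T v∈ in ∈-resp-≈ T (T.sym v≈gx) (into x∈))
    (λ y∈ → let x , x∈ , y≈gx = onto y∈ in ∈-resp-≈ T (T.sym y≈gx) (∈-map⁺ S T g-cong x∈))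

module IntegerCoefficients {c ℓ} (R : CommutativeRing c ℓ) where
  open CommutativeRing R
  open import Algebra.Properties.Ring ring using (-1*x≈-x)
  open import Algebra.Properties.Group +-group using (ε⁻¹≈ε; ⁻¹-involutive)
  open import Algebra.Properties.AbelianGroup +-abelianGroup using (⁻¹-∙-comm)
  open import Algebra.Properties.Semiring.Mult semiring using (×-homo-+; ×1-homo-*) renaming (_×_ to _×ₙ_)
  open import Relation.Binary.Reasoning.Setoid setoid

  ⟦_⟧ˢ : Sign → Carrier
  ⟦ Sign.+ ⟧ˢ = 1#
  ⟦ Sign.- ⟧ˢ = - 1#

  ⟦_⟧ᶻ : ℤ → Carrier
  ⟦ ℤ.+ n ⟧ᶻ    = n ×ₙ 1#
  ⟦ -[1+ n ] ⟧ᶻ = - (suc n ×ₙ 1#)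

  ⟦-⟧ : ∀ i → ⟦ ℤ.- i ⟧ᶻ ≈ - ⟦ i ⟧ᶻ
  ⟦-⟧ (ℤ.+ zero)  = sym ε⁻¹≈ε
  ⟦-⟧ (ℤ.+ suc n) = refl
  ⟦-⟧ -[1+ n ]    = sym (⁻¹-involutive _)

  ⟦⊖⟧ : ∀ m n → ⟦ m ⊖ n ⟧ᶻ ≈ m ×ₙ 1# - n ×ₙ 1#
  ⟦⊖⟧ m       zero    = sym (trans (+-congˡ ε⁻¹≈ε) (+-identityʳ _))
  ⟦⊖⟧ zero    (suc n) = sym (+-identityˡ _)
  ⟦⊖⟧ (suc m) (suc n) = begin
    ⟦ suc m ⊖ suc n ⟧ᶻ            ≡⟨ ≡.cong ⟦_⟧ᶻ (ℤ.[1+m]⊖[1+n]≡m⊖n m n) ⟩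
    ⟦ m ⊖ n ⟧ᶻ                    ≈⟨ ⟦⊖⟧ m n ⟩
    m ×ₙ 1# - n ×ₙ 1#             ≈⟨ cancel 1# (m ×ₙ 1#) (n ×ₙ 1#) ⟨
    suc m ×ₙ 1# - suc n ×ₙ 1#     ∎
    where
    cancel : ∀ x y z → (x + y) - (x + z) ≈ y - z
    cancel x y z = begin
      (x + y) - (x + z)     ≈⟨ +-congˡ (⁻¹-∙-comm x z) ⟨
      (x + y) + (- x - z)   ≈⟨ +-congʳ (+-comm x y) ⟩
      (y + x) + (- x - z)   ≈⟨ +-assoc y x _ ⟩
      y + (x + (- x - z))   ≈⟨ +-congˡ (+-assoc x (- x) (- z)) ⟨
      y + ((x - x) - z)     ≈⟨ +-congˡ (+-congʳ (-‿inverseʳ x)) ⟩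
      y + (0# - z)          ≈⟨ +-congˡ (+-identityˡ (- z)) ⟩
      y - z                 ∎

  ⟦+⟧ : ∀ i j → ⟦ i ℤ.+ j ⟧ᶻ ≈ ⟦ i ⟧ᶻ + ⟦ j ⟧ᶻ
  ⟦+⟧ (ℤ.+ m)  (ℤ.+ n)  = ×-homo-+ 1# m n
  ⟦+⟧ (ℤ.+ m)  -[1+ n ] = ⟦⊖⟧ m (suc n)
  ⟦+⟧ -[1+ m ] (ℤ.+ n)  = trans (⟦⊖⟧ n (suc m)) (+-comm _ _)
  ⟦+⟧ -[1+ m ] -[1+ n ] = begin
    - (suc (suc (m ℕ.+ n)) ×ₙ 1#)       ≡⟨ ≡.cong (λ k → - (suc k ×ₙ 1#)) (ℕ.+-suc m n) ⟨
    - ((suc m ℕ.+ suc n) ×ₙ 1#)         ≈⟨ -‿cong (×-homo-+ 1# (suc m) (suc n)) ⟩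
    - (suc m ×ₙ 1# + suc n ×ₙ 1#)       ≈⟨ ⁻¹-∙-comm _ _ ⟨
    - (suc m ×ₙ 1#) + - (suc n ×ₙ 1#)   ∎

  ⟦◃⟧ : ∀ s n → ⟦ s ◃ n ⟧ᶻ ≈ ⟦ s ⟧ˢ * (n ×ₙ 1#)
  ⟦◃⟧ Sign.+ zero    = sym (*-identityˡ _)
  ⟦◃⟧ Sign.- zero    = sym (zeroʳ _)
  ⟦◃⟧ Sign.+ (suc n) = sym (*-identityˡ _)
  ⟦◃⟧ Sign.- (suc n) = sym (-1*x≈-x _)

  ⟦sign⟧ : ∀ s t → ⟦ s Sign.* t ⟧ˢ ≈ ⟦ s ⟧ˢ * ⟦ t ⟧ˢ
  ⟦sign⟧ Sign.+ t      = sym (*-identityˡ _)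
  ⟦sign⟧ Sign.- Sign.+ = sym (*-identityʳ _)
  ⟦sign⟧ Sign.- Sign.- = sym (trans (-1*x≈-x _) (⁻¹-involutive 1#))

  ⟦◃-inverse⟧ : ∀ i → ⟦ i ⟧ᶻ ≈ ⟦ sign i ⟧ˢ * (∣ i ∣ ×ₙ 1#)
  ⟦◃-inverse⟧ i = trans (reflexive (≡.cong ⟦_⟧ᶻ (≡.sym (ℤ.◃-inverse i)))) (⟦◃⟧ (sign i) ∣ i ∣)

  ⟦*⟧ : ∀ i j → ⟦ i ℤ.* j ⟧ᶻ ≈ ⟦ i ⟧ᶻ * ⟦ j ⟧ᶻ
  ⟦*⟧ i j = begin
    ⟦ (sign i Sign.* sign j) ◃ (∣ i ∣ ℕ.* ∣ j ∣) ⟧ᶻ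
      ≈⟨ ⟦◃⟧ (sign i Sign.* sign j) (∣ i ∣ ℕ.* ∣ j ∣) ⟩
    ⟦ sign i Sign.* sign j ⟧ˢ * ((∣ i ∣ ℕ.* ∣ j ∣) ×ₙ 1#)
      ≈⟨ *-cong (⟦sign⟧ (sign i) (sign j)) (×1-homo-* ∣ i ∣ ∣ j ∣) ⟩
    (⟦ sign i ⟧ˢ * ⟦ sign j ⟧ˢ) * ((∣ i ∣ ×ₙ 1#) * (∣ j ∣ ×ₙ 1#))
      ≈⟨ interchange _ _ _ _ ⟩
    (⟦ sign i ⟧ˢ * (∣ i ∣ ×ₙ 1#)) * (⟦ sign j ⟧ˢ * (∣ j ∣ ×ₙ 1#))
      ≈⟨ *-cong (⟦◃-inverse⟧ i) (⟦◃-inverse⟧ j) ⟨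
    ⟦ i ⟧ᶻ * ⟦ j ⟧ᶻ
      ∎
    where open import Algebra.Properties.CommutativeSemigroup *-commutativeSemigroup using (interchange)

  homomorphism : ℤ.+-*-rawRing -Raw-AlmostCommutative⟶ fromCommutativeRing R
  homomorphism = record
    { ⟦_⟧ = ⟦_⟧ᶻ ; +-homo = ⟦+⟧ ; *-homo = ⟦*⟧ ; -‿homo = ⟦-⟧
    ; 0-homo = refl ; 1-homo = +-identityʳ 1# }

  coefficient≟ : ∀ i j → Maybe (⟦ i ⟧ᶻ ≈ ⟦ j ⟧ᶻ)
  coefficient≟ i j with i ℤ.≟ j
  ... | yes ≡.refl = just refl
  ... | no _       = nothing

  open import Algebra.Solver.Ring ℤ.+-*-rawRing (fromCommutativeRing R) homomorphism coefficient≟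
    public using (solve; _:=_; _:+_; _:*_; _:-_; :-_)

module FiniteFieldProperties {N : ℕ} (F : FiniteField N) where
  open FiniteField F hiding (zero)
  open IntegerCoefficients commRing using (solve; _:=_; _:+_; _:*_; _:-_; :-_)
  open import Algebra.Properties.Semiring.Mult semiring
    using (×-congʳ; ×-assoc-*; ×1-homo-*) renaming (_×_ to _×ₙ_)
  open import Algebra.Properties.Semiring.Exp semiring
    using (^-congˡ; ^-assocʳ) renaming (_^_ to _^ᶠ_)
  open import Algebra.Properties.CommutativeSemiring.Exp commutativeSemiring using (^-distrib-*)
  import Algebra.Properties.CommutativeSemiring.Binomial commutativeSemiring as Binomial
  open import Algebra.Properties.Group +-group using (∙-cancelˡ; identityˡ-unique)
  open import Algebra.Properties.Monoid.Sum +-monoid using (sum; sum-init-last; sum-cong-≋; sum-replicate-zero)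
  open import Relation.Binary.Reasoning.Setoid setoid
  open import Data.List.Membership.Setoid setoid using (_∈_)
  open import Data.List.Membership.Setoid.Properties using (∈-filter⁺; ∈-filter⁻)
  open import Data.List.Relation.Unary.Unique.Setoid setoid using (Unique)
  import Data.List.Relation.Unary.Unique.Setoid.Properties as Unique
  open import Data.List.Relation.Binary.Permutation.Setoid setoid using (_↭_)
  open import Data.List.Relation.Binary.Permutation.Setoid.Properties setoid
    using (xs↭ys⇒|xs|≡|ys|; foldr-commMonoid)
  open UniqueLists setoid using (unique-⊆-⊇⇒↭)

  -- _⁻¹ sends 0# to the junk value 0#; its lemmas all assume a nonzero argument.
  _⁻¹ : Carrier → Carrier
  x ⁻¹ with x ≟ 0#
  ... | yes _   = 0#
  ... | no x≉0 = proj₁ (inverse x x≉0)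

  ⁻¹-inverseʳ : ∀ {x} → x ≉ 0# → x * x ⁻¹ ≈ 1#
  ⁻¹-inverseʳ {x} x≉0 with x ≟ 0#
  ... | yes x≈0  = ⊥-elim (x≉0 x≈0)
  ... | no x≉0′ = proj₂ (inverse x x≉0′)

  *-cancelˡ : ∀ {x y z} → x ≉ 0# → x * y ≈ x * z → y ≈ z
  *-cancelˡ {x} {y} {z} x≉0 xy≈xz = begin
    y                   ≈⟨ rearrange y ⟩
    x ⁻¹ * (x * y)      ≈⟨ *-congˡ xy≈xz ⟩
    x ⁻¹ * (x * z)      ≈⟨ rearrange z ⟨
    z                   ∎
    where
    rearrange : ∀ w → w ≈ x ⁻¹ * (x * w)
    rearrange w = begin
      w                  ≈⟨ *-identityˡ w ⟨
      1# * w             ≈⟨ *-congʳ (trans (*-comm _ _) (⁻¹-inverseʳ x≉0)) ⟨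
      (x ⁻¹ * x) * w     ≈⟨ *-assoc _ _ _ ⟩
      x ⁻¹ * (x * w)     ∎

  x*y≈0⇒x≈0⊎y≈0 : ∀ {x y} → x * y ≈ 0# → x ≈ 0# ⊎ y ≈ 0#
  x*y≈0⇒x≈0⊎y≈0 {x} {y} xy≈0 with x ≟ 0#
  ... | yes x≈0 = inj₁ x≈0
  ... | no x≉0  = inj₂ (*-cancelˡ x≉0 (trans xy≈0 (sym (zeroʳ x))))

  *-nonzero : ∀ {x y} → x ≉ 0# → y ≉ 0# → x * y ≉ 0#
  *-nonzero x≉0 y≉0 xy≈0 with x*y≈0⇒x≈0⊎y≈0 xy≈0
  ... | inj₁ x≈0 = x≉0 x≈0
  ... | inj₂ y≈0 = y≉0 y≈0

  ⁻¹-unique : ∀ {x y} → x * y ≈ 1# → y ≈ x ⁻¹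
  ⁻¹-unique {x} {y} xy≈1 = *-cancelˡ x≉0 (trans xy≈1 (sym (⁻¹-inverseʳ x≉0)))
    where
    x≉0 : x ≉ 0#
    x≉0 x≈0 = 0≉1 (trans (sym (zeroˡ y)) (trans (*-congʳ (sym x≈0)) xy≈1))

  pow≡^ : ∀ x m → pow x m ≡ x ^ᶠ m
  pow≡^ x zero    = ≡.refl
  pow≡^ x (suc m) = ≡.cong (x *_) (pow≡^ x m)

  pow-cong : ∀ {x y} m → x ≈ y → pow x m ≈ pow y m
  pow-cong {x} {y} m x≈y rewrite pow≡^ x m | pow≡^ y m = ^-congˡ m x≈y

  pow-pow : ∀ x m n → pow (pow x m) n ≈ pow x (m ℕ.* n)
  pow-pow x m n rewrite pow≡^ (pow x m) n | pow≡^ x m | pow≡^ x (m ℕ.* n) = ^-assocʳ x m n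

  pow-distrib-* : ∀ x y m → pow (x * y) m ≈ pow x m * pow y m
  pow-distrib-* x y m rewrite pow≡^ (x * y) m | pow≡^ x m | pow≡^ y m = ^-distrib-* x y m

  pow-1# : ∀ m → pow 1# m ≈ 1#
  pow-1# zero    = refl
  pow-1# (suc m) = trans (*-identityˡ _) (pow-1# m)

  pow-0# : ∀ {m} → 1 ≤ m → pow 0# m ≈ 0#
  pow-0# {suc m} _ = zeroˡ _

  pow-nonzero : ∀ {x} m → x ≉ 0# → pow x m ≉ 0#
  pow-nonzero zero    _   = 0≉1 ∘ sym
  pow-nonzero (suc m) x≉0 = *-nonzero x≉0 (pow-nonzero m x≉0)

  pow-neg-even : ∀ x m → pow (- x) (m ℕ.* 2) ≈ pow x (m ℕ.* 2)
  pow-neg-even x zero    = refl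
  pow-neg-even x (suc m) = begin
    - x * (- x * pow (- x) (m ℕ.* 2))  ≈⟨ *-assoc _ _ _ ⟨
    (- x * - x) * pow (- x) (m ℕ.* 2)  ≈⟨ *-cong (neg*neg x) (pow-neg-even x m) ⟩
    (x * x) * pow x (m ℕ.* 2)          ≈⟨ *-assoc _ _ _ ⟩
    x * (x * pow x (m ℕ.* 2))          ∎
    where
    neg*neg : ∀ x → - x * - x ≈ x * x
    neg*neg = solve 1 (λ x → (:- x) :* (:- x) := x :* x) refl

  module _ {P Q : Pred Carrier 0ℓ} (P? : Decidable P) (Q? : Decidable Q) where

    count-cong : (∀ {x} → P x → Q x) → (∀ {x} → Q x → P x) → count P? ≡ count Q?
    count-cong P⇒Q Q⇒P = ≡.cong length (List.filter-≐ P? Q? (P⇒Q , Q⇒P) elements)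

    count-⊎ : (∀ {x} → P x → Q x → ⊥) → count (λ x → P? x ⊎-dec Q? x) ≡ count P? ℕ.+ count Q?
    count-⊎ disjoint = go elements
      where
      go : ∀ xs → length (filter (λ x → P? x ⊎-dec Q? x) xs)
                ≡ length (filter P? xs) ℕ.+ length (filter Q? xs)
      go []       = ≡.refl
      go (x ∷ xs) with P? x | Q? x
      ... | yes p | yes q = ⊥-elim (disjoint p q)
      ... | yes _ | no _  = ≡.cong suc (go xs)
      ... | no _  | yes _ = ≡.trans (≡.cong suc (go xs)) (≡.sym (ℕ.+-suc _ _))
      ... | no _  | no _  = go xs

    count-↔ : P Respects _≈_ → Q Respects _≈_ → (g : Carrier → Carrier) → g Preserves _≈_ ⟶ _≈_ →
      (∀ {x} → P x → Q (g x)) → (∀ {x y} → P x → P y → g x ≈ g y → x ≈ y) →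
      (∀ {y} → Q y → ∃ λ x → P x × y ≈ g x) → count P? ≡ count Q?
    count-↔ P-resp Q-resp g g-cong P⇒Q inj onto =
      ≡.trans (≡.sym (List.length-map g (filter P? elements)))
              (xs↭ys⇒|xs|≡|ys| (map-↭ setoid setoid g-cong (λ x∈ y∈ → inj (inP x∈) (inP y∈)) into onto′
                                  (Unique.filter⁺ setoid P? distinct) (Unique.filter⁺ setoid Q? distinct)))
      where
      inP : ∀ {x} → x ∈ filter P? elements → P x
      inP x∈ = proj₂ (∈-filter⁻ setoid P? P-resp {xs = elements} x∈)
      into : ∀ {x} → x ∈ filter P? elements → g x ∈ filter Q? elements
      into x∈ = ∈-filter⁺ setoid Q? Q-resp (complete _) (P⇒Q (inP x∈))
      onto′ : ∀ {y} → y ∈ filter Q? elements → ∃ λ x → x ∈ filter P? elements × y ≈ g x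
      onto′ y∈ = let x , Px , y≈gx = onto (proj₂ (∈-filter⁻ setoid Q? Q-resp {xs = elements} y∈))
                 in x , ∈-filter⁺ setoid P? P-resp (complete x) Px , y≈gx

  count-none : ∀ {P : Pred Carrier 0ℓ} (P? : Decidable P) → (∀ x → ¬ P x) → count P? ≡ 0
  count-none P? ¬P = ≡.cong length (List.filter-none P? {elements} (All.tabulate λ {x} _ → ¬P x))

  count-≈0 : count (_≟ 0#) ≡ 1
  count-≈0 = xs↭ys⇒|xs|≡|ys| (unique-⊆-⊇⇒↭ (Unique.filter⁺ setoid (_≟ 0#) distinct) ([] ∷ [])
    (λ x∈ → here (proj₂ (∈-filter⁻ setoid (_≟ 0#) ≈0-resp {xs = elements} x∈)))
    (λ { (here x≈0) → ∈-filter⁺ setoid (_≟ 0#) ≈0-resp (complete _) x≈0 }))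
    where
    ≈0-resp : (_≈ 0#) Respects _≈_
    ≈0-resp x≈y x≈0 = trans (sym x≈y) x≈0

  count-∖0 : ∀ {P : Pred Carrier 0ℓ} (P? : Decidable P) → P Respects _≈_ → P 0# →
    count (λ x → P? x ×-dec ¬? (x ≟ 0#)) ≡ count P? ∸ 1
  count-∖0 {P} P? P-resp P0 = ≡.sym (≡.trans (≡.cong (_∸ 1) count-P) (ℕ.m+n∸n≡m _ 1))
    where
    split? = λ x → (P? x ×-dec ¬? (x ≟ 0#)) ⊎-dec (x ≟ 0#)
    to : ∀ {x} → P x → (P x × x ≉ 0#) ⊎ x ≈ 0#
    to {x} Px with x ≟ 0#
    ... | yes x≈0 = inj₂ x≈0
    ... | no x≉0  = inj₁ (Px , x≉0)
    from : ∀ {x} → (P x × x ≉ 0#) ⊎ x ≈ 0# → P x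
    from (inj₁ (Px , _)) = Px
    from (inj₂ x≈0)      = P-resp (sym x≈0) P0
    count-P : count P? ≡ count (λ x → P? x ×-dec ¬? (x ≟ 0#)) ℕ.+ 1
    count-P = ≡.trans (count-cong P? split? to from)
              (≡.trans (count-⊎ (λ x → P? x ×-dec ¬? (x ≟ 0#)) (_≟ 0#) (λ (_ , x≉0) x≈0 → x≉0 x≈0))
                       (≡.cong (count (λ x → P? x ×-dec ¬? (x ≟ 0#)) ℕ.+_) count-≈0))

  count-≉0 : count (λ x → ¬? (x ≟ 0#)) ≡ N ∸ 1
  count-≉0 =
    ≡.trans (count-cong (λ x → ¬? (x ≟ 0#)) (λ x → yes′ x ×-dec ¬? (x ≟ 0#)) (tt ,_) proj₂)
    (≡.trans (count-∖0 yes′ _ tt)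
             (≡.cong (_∸ 1) (≡.trans (≡.cong length (List.filter-all yes′ (All.universal _ elements))) size)))
    where
    yes′ : Decidable (λ (_ : Carrier) → ⊤)
    yes′ _ = yes tt

  sum-map-1#+ : ∀ xs → foldr _+_ 0# (map (1# +_) xs) ≈ length xs ×ₙ 1# + foldr _+_ 0# xs
  sum-map-1#+ []       = sym (+-identityˡ 0#)
  sum-map-1#+ (x ∷ xs) = trans (+-congˡ (sum-map-1#+ xs)) (interchange 1# x _ _)
    where open import Algebra.Properties.CommutativeSemigroup +-commutativeSemigroup using (interchange)

  -- Translation by 1# permutes the field, so it fixes the sum of all elements.
  N×1#≈0# : N ×ₙ 1# ≈ 0#
  N×1#≈0# = identityˡ-unique (N ×ₙ 1#) (foldr _+_ 0# elements) (begin
    N ×ₙ 1# + foldr _+_ 0# elements                ≡⟨ ≡.cong (λ n → n ×ₙ 1# + foldr _+_ 0# elements) size ⟨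
    length elements ×ₙ 1# + foldr _+_ 0# elements  ≈⟨ sum-map-1#+ elements ⟨
    foldr _+_ 0# (map (1# +_) elements)            ≈⟨ foldr-commMonoid +-isCommutativeMonoid shift↭ ⟩
    foldr _+_ 0# elements                          ∎)
    where
    shift↭ : map (1# +_) elements ↭ elements
    shift↭ = map-↭ setoid setoid +-congˡ (λ _ _ → ∙-cancelˡ 1# _ _) (λ _ → complete _)
      (λ {y} _ → y - 1# , complete _ , undo y) distinct distinct
      where
      undo : ∀ y → y ≈ 1# + (y - 1#)
      undo y = solve 2 (λ y o → y := o :+ (y :- o)) refl y 1#

  ≉0-resp : (_≉ 0#) Respects _≈_
  ≉0-resp x≈y x≉0 y≈0 = x≉0 (trans x≈y y≈0)

  product-map-* : ∀ x xs → foldr _*_ 1# (map (x *_) xs) ≈ pow x (length xs) * foldr _*_ 1# xs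
  product-map-* x []       = sym (*-identityˡ 1#)
  product-map-* x (y ∷ ys) = trans (*-congˡ (product-map-* x ys)) (interchange x y _ _)
    where open import Algebra.Properties.CommutativeSemigroup *-commutativeSemigroup using (interchange)

  product-nonzero : ∀ {xs} → All (_≉ 0#) xs → foldr _*_ 1# xs ≉ 0#
  product-nonzero []            = 0≉1 ∘ sym
  product-nonzero (x≉0 ∷ xs≉0) = *-nonzero x≉0 (product-nonzero xs≉0)

  -- Multiplication by a unit permutes the units, so it fixes their product.
  pow-[N∸1] : ∀ {x} → x ≉ 0# → pow x (N ∸ 1) ≈ 1#
  pow-[N∸1] {x} x≉0 = *-cancelˡ (product-nonzero (All.all-filter ≉0? elements)) (begin
    Π units * pow x (N ∸ 1)                 ≈⟨ *-comm _ _ ⟩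
    pow x (N ∸ 1) * Π units                 ≡⟨ ≡.cong (λ m → pow x m * Π units) count-≉0 ⟨
    pow x (length units) * Π units          ≈⟨ product-map-* x units ⟨
    Π (map (x *_) units)                    ≈⟨ foldr-commMonoid *-isCommutativeMonoid scale↭ ⟩
    Π units                                 ≈⟨ *-identityʳ _ ⟨
    Π units * 1#                            ∎)
    where
    ≉0? : Decidable (_≉ 0#)
    ≉0? x = ¬? (x ≟ 0#)
    units = filter ≉0? elements
    Π = foldr _*_ 1#
    x⁻¹≉0 : x ⁻¹ ≉ 0#
    x⁻¹≉0 x⁻¹≈0 = 0≉1 (trans (sym (zeroʳ x)) (trans (*-congˡ (sym x⁻¹≈0)) (⁻¹-inverseʳ x≉0)))
    unit : ∀ {y} → y ∈ units → y ≉ 0#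
    unit y∈ = proj₂ (∈-filter⁻ setoid ≉0? ≉0-resp {xs = elements} y∈)
    undo : ∀ y → y ≈ x * (x ⁻¹ * y)
    undo y = sym (trans (sym (*-assoc _ _ _)) (trans (*-congʳ (⁻¹-inverseʳ x≉0)) (*-identityˡ y)))
    scale↭ : map (x *_) units ↭ units
    scale↭ = map-↭ setoid setoid *-congˡ (λ _ _ → *-cancelˡ x≉0)
      (λ y∈ → ∈-filter⁺ setoid ≉0? ≉0-resp (complete _) (*-nonzero x≉0 (unit y∈)))
      (λ {y} y∈ → x ⁻¹ * y , ∈-filter⁺ setoid ≉0? ≉0-resp (complete _) (*-nonzero x⁻¹≉0 (unit y∈)) , undo y)
      (Unique.filter⁺ setoid ≉0? distinct) (Unique.filter⁺ setoid ≉0? distinct)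

  1+[N∸1]≡N : suc (N ∸ 1) ≡ N
  1+[N∸1]≡N = ℕ.m+[n∸m]≡n (≡.subst (1 ≤_) size (nonempty (complete 0#)))
    where
    nonempty : ∀ {xs : List Carrier} → 0# ∈ xs → 1 ≤ length xs
    nonempty {_ ∷ _} _ = s≤s z≤n

  pow-N : ∀ x → pow x N ≈ x
  pow-N x with x ≟ 0#
  ... | yes x≈0 = begin
    pow x N                ≡⟨ ≡.cong (pow x) 1+[N∸1]≡N ⟨
    x * pow x (N ∸ 1)      ≈⟨ *-congʳ x≈0 ⟩
    0# * pow x (N ∸ 1)     ≈⟨ zeroˡ _ ⟩
    0#                     ≈⟨ x≈0 ⟨
    x                      ∎
  ... | no x≉0 = begin
    pow x N                ≡⟨ ≡.cong (pow x) 1+[N∸1]≡N ⟨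
    x * pow x (N ∸ 1)      ≈⟨ *-congˡ (pow-[N∸1] x≉0) ⟩
    x * 1#                 ≈⟨ *-identityʳ x ⟩
    x                      ∎

  -- (c₀ ∷ … ∷ c_{d-1} ∷ []) encodes the monic polynomial c₀ + c₁ X + ⋯ + c_{d-1} X^{d-1} + X^d.
  evalMonic : ∀ {d} → Vec Carrier d → Carrier → Carrier
  evalMonic []       x = 1#
  evalMonic (c ∷ cs) x = c + x * evalMonic cs x

  quotient : ∀ {d} → Vec Carrier (suc d) → Carrier → Vec Carrier d
  quotient (c ∷ [])      r = []
  quotient (c ∷ c′ ∷ cs) r = evalMonic (c′ ∷ cs) r ∷ quotient (c′ ∷ cs) r

  evalMonic-quotient : ∀ {d} (cs : Vec Carrier (suc d)) r x →
    evalMonic cs x ≈ (x - r) * evalMonic (quotient cs r) x + evalMonic cs r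
  evalMonic-quotient (c ∷ []) r x = step c r x 1#
    where
    step : ∀ c r x o → c + x * o ≈ (x - r) * o + (c + r * o)
    step = solve 4 (λ c r x o → c :+ x :* o := (x :- r) :* o :+ (c :+ r :* o)) refl
  evalMonic-quotient (c ∷ c′ ∷ cs) r x =
    trans (+-congˡ (*-congˡ (evalMonic-quotient (c′ ∷ cs) r x))) (step c x r _ _)
    where
    step : ∀ c x r q v → c + x * ((x - r) * q + v) ≈ (x - r) * (v + x * q) + (c + r * v)
    step = solve 5 (λ c x r q v → c :+ x :* ((x :- r) :* q :+ v)
                                 := (x :- r) :* (v :+ x :* q) :+ (c :+ r :* v)) refl

  roots≤degree : ∀ {d} (cs : Vec Carrier d) {rs} → Unique rs → All (λ r → evalMonic cs r ≈ 0#) rs → length rs ≤ d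
  roots≤degree cs       {[]}    _            _                = z≤n
  roots≤degree []       {_ ∷ _} _            (1≈0 ∷ _)        = ⊥-elim (0≉1 (sym 1≈0))
  roots≤degree (c ∷ cs) {r ∷ rs} (r∉rs ∷ rs!) (root ∷ roots) =
    s≤s (roots≤degree (quotient (c ∷ cs) r) rs! (All.zipWith other-root (r∉rs , roots)))
    where
    other-root : ∀ {s} → (r ≉ s) × evalMonic (c ∷ cs) s ≈ 0# → evalMonic (quotient (c ∷ cs) r) s ≈ 0#
    other-root {s} (r≉s , s-root) with x*y≈0⇒x≈0⊎y≈0 (begin
      (s - r) * evalMonic (quotient (c ∷ cs) r) s            ≈⟨ +-identityʳ _ ⟨
      (s - r) * evalMonic (quotient (c ∷ cs) r) s + 0#       ≈⟨ +-congˡ root ⟨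
      (s - r) * evalMonic (quotient (c ∷ cs) r) s + evalMonic (c ∷ cs) r ≈⟨ evalMonic-quotient (c ∷ cs) r s ⟨
      evalMonic (c ∷ cs) s                                   ≈⟨ s-root ⟩
      0#                                                     ∎)
    ... | inj₁ s-r≈0 = ⊥-elim (r≉s (sym (trans (solve 2 (λ s r → s := (s :- r) :+ r) refl s r)
                                                 (trans (+-congʳ s-r≈0) (+-identityˡ r)))))
    ... | inj₂ q≈0   = q≈0

  count-roots : ∀ {n} → 2 ≤ n → ∀ b → count (λ x → (pow x n + b * x) ≟ 0#) ≤ n
  count-roots {suc (suc m)} (s≤s (s≤s _)) b =
    roots≤degree (0# ∷ b ∷ zeros m) (Unique.filter⁺ setoid root? distinct)
    (All.map (λ root → trans (evalMonic-xᵐ⁺²+bx _) root) (All.all-filter root? elements))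
    where
    root? = λ x → (pow x (suc (suc m)) + b * x) ≟ 0#
    zeros : ∀ k → Vec Carrier k
    zeros zero    = []
    zeros (suc k) = 0# ∷ zeros k
    evalMonic-zeros : ∀ k x → evalMonic (zeros k) x ≈ pow x k
    evalMonic-zeros zero    x = refl
    evalMonic-zeros (suc k) x = trans (+-identityˡ _) (*-congˡ (evalMonic-zeros k x))
    evalMonic-xᵐ⁺²+bx : ∀ x → evalMonic (0# ∷ b ∷ zeros m) x ≈ pow x (suc (suc m)) + b * x
    evalMonic-xᵐ⁺²+bx x = begin
      0# + x * (b + x * evalMonic (zeros m) x)   ≈⟨ +-identityˡ _ ⟩
      x * (b + x * evalMonic (zeros m) x)        ≈⟨ *-congˡ (+-congˡ (*-congˡ (evalMonic-zeros m x))) ⟩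
      x * (b + x * pow x m)                      ≈⟨ step x b (pow x m) ⟩
      x * (x * pow x m) + b * x                  ∎
      where
      step : ∀ x b p → x * (b + x * p) ≈ x * (x * p) + b * x
      step = solve 3 (λ x b p → x :* (b :+ x :* p) := x :* (x :* p) :+ b :* x) refl

  ×≈×1#* : ∀ n x → n ×ₙ x ≈ (n ×ₙ 1#) * x
  ×≈×1#* n x = trans (×-congʳ n (sym (*-identityˡ x))) (sym (×-assoc-* n 1# x))

  pow×1#≈0⇒×1#≈0 : ∀ m j → (m ℕ.^ j) ×ₙ 1# ≈ 0# → m ×ₙ 1# ≈ 0#
  pow×1#≈0⇒×1#≈0 m zero    1+0≈0 = ⊥-elim (0≉1 (sym (trans (sym (+-identityʳ 1#)) 1+0≈0)))
  pow×1#≈0⇒×1#≈0 m (suc j) mᵏ⁺¹≈0 with x*y≈0⇒x≈0⊎y≈0 (trans (sym (×1-homo-* m (m ℕ.^ j))) mᵏ⁺¹≈0)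
  ... | inj₁ m≈0  = m≈0
  ... | inj₂ mʲ≈0 = pow×1#≈0⇒×1#≈0 m j mʲ≈0

  p∣m⇒m×x≈0 : ∀ {p m} x → p ×ₙ 1# ≈ 0# → p ∣ m → m ×ₙ x ≈ 0#
  p∣m⇒m×x≈0 {p} x p×1≈0 (divides r ≡.refl) = begin
    (r ℕ.* p) ×ₙ x                ≈⟨ ×≈×1#* (r ℕ.* p) x ⟩
    ((r ℕ.* p) ×ₙ 1#) * x         ≈⟨ *-congʳ (×1-homo-* r p) ⟩
    ((r ×ₙ 1#) * (p ×ₙ 1#)) * x   ≈⟨ *-congʳ (*-congˡ p×1≈0) ⟩
    ((r ×ₙ 1#) * 0#) * x          ≈⟨ *-congʳ (zeroʳ _) ⟩
    0# * x                        ≈⟨ zeroˡ x ⟩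
    0#                            ∎

  sum-ends : ∀ n (t : Fin (suc (suc n)) → Carrier) → (∀ (i : Fin n) → t (Fin.suc (Fin.inject₁ i)) ≈ 0#) →
    sum t ≈ t Fin.zero + t (Fin.fromℕ (suc n))
  sum-ends n t middle≈0 = +-congˡ (begin
    sum (t ∘ Fin.suc)                                                 ≈⟨ sum-init-last (t ∘ Fin.suc) ⟩
    sum (λ i → t (Fin.suc (Fin.inject₁ i))) + t (Fin.fromℕ (suc n))
      ≈⟨ +-congʳ (trans (sum-cong-≋ middle≈0) (sum-replicate-zero n)) ⟩
    0# + t (Fin.fromℕ (suc n))                                        ≈⟨ +-identityˡ _ ⟩
    t (Fin.fromℕ (suc n))                                             ∎)

  pow-+-prime : ∀ {p} → Prime p → p ×ₙ 1# ≈ 0# → ∀ x y → pow (x + y) p ≈ pow x p + pow y p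
  pow-+-prime {0}           p-prime _ = ⊥-elim (¬prime[0] p-prime)
  pow-+-prime {1}           p-prime _ = ⊥-elim (¬prime[1] p-prime)
  pow-+-prime {p@(suc (suc m))} p-prime p×1≈0 x y = begin
    pow (x + y) p                 ≡⟨ pow≡^ (x + y) p ⟩
    (x + y) ^ᶠ p                  ≈⟨ Binomial.theorem p x y ⟩
    sum (term p)                  ≈⟨ sum-ends (suc m) (term p) middle≈0 ⟩
    term p Fin.zero + term p (Fin.fromℕ p) ≈⟨ +-cong (trans (+-identityʳ _) (*-identityˡ _)) (last p) ⟩
    y ^ᶠ p + x ^ᶠ p               ≈⟨ +-comm _ _ ⟩
    x ^ᶠ p + y ^ᶠ p               ≡⟨ ≡.cong₂ _+_ (pow≡^ x p) (pow≡^ y p) ⟨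
    pow x p + pow y p             ∎
    where
    term = Binomial.binomialTerm x y
    last : ∀ n → term n (Fin.fromℕ n) ≈ x ^ᶠ n
    last n rewrite Fin.toℕ-fromℕ n | nCn≡1 n | ℕ.n∸n≡0 n = trans (+-identityʳ _) (*-identityʳ _)
    middle≈0 : ∀ (i : Fin (suc m)) → term p (Fin.suc (Fin.inject₁ i)) ≈ 0#
    middle≈0 i = p∣m⇒m×x≈0 _ p×1≈0 (prime∣pCk p-prime (s≤s z≤n)
      (s≤s (≡.subst (ℕ._< suc m) (≡.sym (Fin.toℕ-inject₁ i)) (Fin.toℕ<n i))))

  pow-+-prime^ : ∀ {p} → Prime p → p ×ₙ 1# ≈ 0# →
    ∀ j x y → pow (x + y) (p ℕ.^ j) ≈ pow x (p ℕ.^ j) + pow y (p ℕ.^ j)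
  pow-+-prime^ p-prime p×1≈0 zero    x y = trans (*-identityʳ _) (sym (+-cong (*-identityʳ x) (*-identityʳ y)))
  pow-+-prime^ {p} p-prime p×1≈0 (suc j) x y = begin
    pow (x + y) (p ℕ.* p ℕ.^ j)                      ≈⟨ pow-pow (x + y) p (p ℕ.^ j) ⟨
    pow (pow (x + y) p) (p ℕ.^ j)                    ≈⟨ pow-cong (p ℕ.^ j) (pow-+-prime p-prime p×1≈0 x y) ⟩
    pow (pow x p + pow y p) (p ℕ.^ j)                ≈⟨ pow-+-prime^ p-prime p×1≈0 j _ _ ⟩
    pow (pow x p) (p ℕ.^ j) + pow (pow y p) (p ℕ.^ j) ≈⟨ +-cong (pow-pow x p _) (pow-pow y p _) ⟩
    pow x (p ℕ.* p ℕ.^ j) + pow y (p ℕ.* p ℕ.^ j)    ∎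

module FieldOfOrderSquare {p k : ℕ} (p-prime : Prime p) (p-odd : p % 2 ≡ 1) (1≤k : 1 ≤ k)
                          (F : FiniteField (p ^ k ℕ.* p ^ k)) where
  open FiniteField F hiding (zero)
  open FiniteFieldProperties F
  open IntegerCoefficients commRing using (solve; _:=_; _:+_; _:*_; _:-_)
  open import Algebra.Properties.Semiring.Mult semiring using (×-congˡ; ×1-homo-*) renaming (_×_ to _×ₙ_)
  open import Algebra.Properties.Group +-group using (inverseˡ-unique; identityˡ-unique)
  open import Relation.Binary.Reasoning.Setoid setoid
  open import Data.List.Membership.Setoid.Properties
    using (∈-filter⁺; ∈-filter⁻; ∈-cartesianProduct⁺; ∈-cartesianProduct⁻)
  import Data.List.Relation.Unary.Unique.Setoid.Properties as Unique
  open import Data.List.Relation.Binary.Permutation.Setoid.Properties (setoid ×ₛ setoid) using (xs↭ys⇒|xs|≡|ys|)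
  open import Data.List.Relation.Binary.Permutation.Setoid (setoid ×ₛ setoid) using (_↭_)
  open import Data.List.Membership.Setoid setoid using (_∈_)

  q : ℕ
  q = p ^ k

  2≤q : 2 ≤ q
  2≤q = 2≤m^n (ℕ.nonTrivial⇒n>1 p {{prime⇒nonTrivial p-prime}}) 1≤k

  p×1#≈0# : p ×ₙ 1# ≈ 0#
  p×1#≈0# = pow×1#≈0⇒×1#≈0 p (k ℕ.+ k) (trans (×-congˡ (ℕ.^-distribˡ-+-* p k k)) N×1#≈0#)

  two : Carrier
  two = 1# + 1#

  two≉0 : two ≉ 0#
  two≉0 two≈0 = 0≉1 (sym (begin
    1#                              ≈⟨ +-identityʳ 1# ⟨
    1# + 0#                         ≈⟨ +-congˡ (trans (sym (zeroʳ _)) (*-congˡ (sym 2×1#≈0))) ⟩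
    1# + ((p / 2) ×ₙ 1#) * (2 ×ₙ 1#) ≈⟨ +-congˡ (×1-homo-* (p / 2) 2) ⟨
    suc (p / 2 ℕ.* 2) ×ₙ 1#         ≡⟨ ≡.cong (_×ₙ 1#) p≡1+[p/2]*2 ⟨
    p ×ₙ 1#                         ≈⟨ p×1#≈0# ⟩
    0#                              ∎))
    where
    2×1#≈0 : 2 ×ₙ 1# ≈ 0#
    2×1#≈0 = trans (+-congˡ (+-identityʳ 1#)) two≈0
    p≡1+[p/2]*2 : p ≡ suc (p / 2 ℕ.* 2)
    p≡1+[p/2]*2 = ≡.trans (m≡m%n+[m/n]*n p 2) (≡.cong (ℕ._+ p / 2 ℕ.* 2) p-odd)

  half : Carrier
  half = two ⁻¹

  half*[x+x] : ∀ x → half * (x + x) ≈ x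
  half*[x+x] x = begin
    half * (x + x)
      ≈⟨ *-congˡ (+-cong (*-identityʳ x) (*-identityʳ x)) ⟨
    half * (x * 1# + x * 1#)
      ≈⟨ solve 3 (λ h x o → h :* (x :* o :+ x :* o) := (o :+ o) :* h :* x) refl half x 1# ⟩
    two * half * x
      ≈⟨ *-congʳ (⁻¹-inverseʳ two≉0) ⟩
    1# * x
      ≈⟨ *-identityˡ x ⟩
    x ∎

  frob : Carrier → Carrier
  frob x = pow x q

  frob-cong : ∀ {x y} → x ≈ y → frob x ≈ frob y
  frob-cong = pow-cong q

  frob-+ : ∀ x y → frob (x + y) ≈ frob x + frob y
  frob-+ = pow-+-prime^ p-prime p×1#≈0# k

  frob-* : ∀ x y → frob (x * y) ≈ frob x * frob y
  frob-* x y = pow-distrib-* x y q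

  frob-1# : frob 1# ≈ 1#
  frob-1# = pow-1# q

  frob-0# : frob 0# ≈ 0#
  frob-0# = identityˡ-unique (frob 0#) (frob 0#) (trans (sym (frob-+ 0# 0#)) (frob-cong (+-identityˡ 0#)))

  frob-neg : ∀ x → frob (- x) ≈ - frob x
  frob-neg x = inverseˡ-unique (frob (- x)) (frob x)
    (trans (sym (frob-+ (- x) x)) (trans (frob-cong (-‿inverseˡ x)) frob-0#))

  frob-sub : ∀ x y → frob (x - y) ≈ frob x - frob y
  frob-sub x y = trans (frob-+ x (- y)) (+-congˡ (frob-neg y))

  frob-pow : ∀ x m → frob (pow x m) ≈ pow (frob x) m
  frob-pow x m = begin
    pow (pow x m) q     ≈⟨ pow-pow x m q ⟩
    pow x (m ℕ.* q)     ≡⟨ ≡.cong (pow x) (ℕ.*-comm m q) ⟩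
    pow x (q ℕ.* m)     ≈⟨ pow-pow x q m ⟨
    pow (pow x q) m     ∎

  frob-involutive : ∀ x → frob (frob x) ≈ x
  frob-involutive x = trans (pow-pow x q q) (pow-N x)

  frob-fixes-⁻¹ : ∀ {w} → w ≉ 0# → frob w ≈ w → frob (w ⁻¹) ≈ w ⁻¹
  frob-fixes-⁻¹ {w} w≉0 frob-w≈w = ⁻¹-unique (begin
    w * frob (w ⁻¹)          ≈⟨ *-congʳ frob-w≈w ⟨
    frob w * frob (w ⁻¹)     ≈⟨ frob-* w (w ⁻¹) ⟨
    frob (w * w ⁻¹)          ≈⟨ frob-cong (⁻¹-inverseʳ w≉0) ⟩
    frob 1#                  ≈⟨ frob-1# ⟩
    1#                       ∎)

  frob-half : frob half ≈ half
  frob-half = frob-fixes-⁻¹ two≉0 (trans (frob-+ 1# 1#) (+-cong frob-1# frob-1#))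

  Tr Δ : Carrier → Carrier
  Tr x = frob x + x
  Δ x = frob x - x

  Tr-cong : ∀ {x y} → x ≈ y → Tr x ≈ Tr y
  Tr-cong x≈y = +-cong (frob-cong x≈y) x≈y

  Δ-cong : ∀ {x y} → x ≈ y → Δ x ≈ Δ y
  Δ-cong x≈y = +-cong (frob-cong x≈y) (-‿cong x≈y)

  Δ≈0⇒frob-fixes : ∀ {u} → Δ u ≈ 0# → frob u ≈ u
  Δ≈0⇒frob-fixes {u} Δu≈0 = begin
    frob u              ≈⟨ solve 2 (λ f u → f := (f :- u) :+ u) refl (frob u) u ⟩
    Δ u + u             ≈⟨ +-congʳ Δu≈0 ⟩
    0# + u              ≈⟨ +-identityˡ u ⟩
    u                   ∎

  Tr≈0⇒frob-negates : ∀ {v} → Tr v ≈ 0# → frob v ≈ - v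
  Tr≈0⇒frob-negates {v} = inverseˡ-unique (frob v) v

  Δ-0# : Δ 0# ≈ 0#
  Δ-0# = trans (+-congʳ frob-0#) (-‿inverseʳ 0#)

  Tr-0# : Tr 0# ≈ 0#
  Tr-0# = trans (+-congʳ frob-0#) (+-identityˡ 0#)

  Δ-Tr : ∀ x → Δ (Tr x) ≈ 0#
  Δ-Tr x = begin
    frob (frob x + x) - (frob x + x)         ≈⟨ +-congʳ (trans (frob-+ (frob x) x) (+-congʳ (frob-involutive x))) ⟩
    (x + frob x) - (frob x + x)              ≈⟨ solve 2 (λ x f → (x :+ f) :- (f :+ x) := x :- x) refl x (frob x) ⟩
    x - x                                    ≈⟨ -‿inverseʳ x ⟩
    0#                                       ∎

  Tr-Δ : ∀ x → Tr (Δ x) ≈ 0#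
  Tr-Δ x = begin
    frob (frob x - x) + (frob x - x)         ≈⟨ +-congʳ (trans (frob-sub (frob x) x) (+-congʳ (frob-involutive x))) ⟩
    (x - frob x) + (frob x - x)              ≈⟨ solve 2 (λ x f → (x :- f) :+ (f :- x) := x :- x) refl x (frob x) ⟩
    x - x                                    ≈⟨ -‿inverseʳ x ⟩
    0#                                       ∎

  unsplit : Carrier → Carrier → Carrier
  unsplit u v = half * (u - v)

  unsplit-Tr-Δ : ∀ x → unsplit (Tr x) (Δ x) ≈ x
  unsplit-Tr-Δ x =
    trans (*-congˡ (solve 2 (λ x f → (f :+ x) :- (f :- x) := x :+ x) refl x (frob x))) (half*[x+x] x)

  frob-unsplit : ∀ {u v} → Δ u ≈ 0# → Tr v ≈ 0# → frob (unsplit u v) ≈ half * (u + v)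
  frob-unsplit {u} {v} Δu≈0 Trv≈0 = begin
    frob (half * (u - v))         ≈⟨ trans (frob-* half (u - v)) (*-cong frob-half (frob-sub u v)) ⟩
    half * (frob u - frob v)      ≈⟨ *-congˡ (+-cong (Δ≈0⇒frob-fixes Δu≈0) (-‿cong (Tr≈0⇒frob-negates Trv≈0))) ⟩
    half * (u - - v)              ≈⟨ *-congˡ (+-congˡ (⁻¹-involutive v)) ⟩
    half * (u + v)                ∎
    where open import Algebra.Properties.Group +-group using (⁻¹-involutive)

  Tr-unsplit : ∀ {u v} → Δ u ≈ 0# → Tr v ≈ 0# → Tr (unsplit u v) ≈ u
  Tr-unsplit {u} {v} Δu≈0 Trv≈0 = begin
    frob (unsplit u v) + half * (u - v)   ≈⟨ +-congʳ (frob-unsplit Δu≈0 Trv≈0) ⟩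
    half * (u + v) + half * (u - v)
      ≈⟨ solve 3 (λ h u v → h :* (u :+ v) :+ h :* (u :- v) := h :* (u :+ u)) refl half u v ⟩
    half * (u + u)                        ≈⟨ half*[x+x] u ⟩
    u                                     ∎

  Δ-unsplit : ∀ {u v} → Δ u ≈ 0# → Tr v ≈ 0# → Δ (unsplit u v) ≈ v
  Δ-unsplit {u} {v} Δu≈0 Trv≈0 = begin
    frob (unsplit u v) - half * (u - v)   ≈⟨ +-congʳ (frob-unsplit Δu≈0 Trv≈0) ⟩
    half * (u + v) - half * (u - v)
      ≈⟨ solve 3 (λ h u v → h :* (u :+ v) :- h :* (u :- v) := h :* (v :+ v)) refl half u v ⟩
    half * (v + v)                        ≈⟨ half*[x+x] v ⟩
    v                                     ∎

  Δ≈0⇒Tr≈0⇒≈0 : ∀ {x} → Δ x ≈ 0# → Tr x ≈ 0# → x ≈ 0#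
  Δ≈0⇒Tr≈0⇒≈0 {x} Δx≈0 Trx≈0 = begin
    x                     ≈⟨ unsplit-Tr-Δ x ⟨
    half * (Tr x - Δ x)   ≈⟨ *-congˡ (+-cong Trx≈0 (-‿cong Δx≈0)) ⟩
    half * (0# - 0#)      ≈⟨ *-congˡ (-‿inverseʳ 0#) ⟩
    half * 0#             ≈⟨ zeroʳ half ⟩
    0#                    ∎

  Δ≈0? : Decidable (λ x → Δ x ≈ 0#)
  Δ≈0? x = Δ x ≟ 0#

  Tr≈0? : Decidable (λ x → Tr x ≈ 0#)
  Tr≈0? x = Tr x ≟ 0#

  Δ≈0-resp : (λ x → Δ x ≈ 0#) Respects _≈_
  Δ≈0-resp x≈y Δx≈0 = trans (Δ-cong (sym x≈y)) Δx≈0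

  Tr≈0-resp : (λ x → Tr x ≈ 0#) Respects _≈_
  Tr≈0-resp x≈y Trx≈0 = trans (Tr-cong (sym x≈y)) Trx≈0

  count-Δ≈0≤q : count Δ≈0? ≤ q
  count-Δ≈0≤q = ≡.subst (_≤ q) (count-cong _ Δ≈0? (trans (+-congˡ -x≈-1*x)) (trans (+-congˡ (sym -x≈-1*x))))
    (count-roots 2≤q (- 1#))
    where
    open import Algebra.Properties.Ring ring using (-1*x≈-x)
    -x≈-1*x : ∀ {x} → - x ≈ - 1# * x
    -x≈-1*x = sym (-1*x≈-x _)

  count-Tr≈0≤q : count Tr≈0? ≤ q
  count-Tr≈0≤q = ≡.subst (_≤ q)
    (count-cong _ Tr≈0? (trans (+-congˡ (sym (*-identityˡ _)))) (trans (+-congˡ (*-identityˡ _))))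
    (count-roots 2≤q 1#)

  count-Δ≈0*count-Tr≈0 : count Δ≈0? ℕ.* count Tr≈0? ≡ q ℕ.* q
  count-Δ≈0*count-Tr≈0 =
    ≡.trans (≡.sym (length-cartesianProduct kerΔ kerTr))
    (≡.trans (≡.sym (xs↭ys⇒|xs|≡|ys| split↭))
    (≡.trans (List.length-map split elements) size))
    where
    kerΔ = filter Δ≈0? elements
    kerTr = filter Tr≈0? elements
    split : Carrier → Carrier × Carrier
    split x = Tr x , Δ x
    in-kerΔ : ∀ {u} → u ∈ kerΔ → Δ u ≈ 0#
    in-kerΔ u∈ = proj₂ (∈-filter⁻ setoid Δ≈0? Δ≈0-resp {xs = elements} u∈)
    in-kerTr : ∀ {v} → v ∈ kerTr → Tr v ≈ 0#
    in-kerTr v∈ = proj₂ (∈-filter⁻ setoid Tr≈0? Tr≈0-resp {xs = elements} v∈)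
    split↭ : map split elements ↭ cartesianProduct kerΔ kerTr
    split↭ = map-↭ setoid (setoid ×ₛ setoid) (λ x≈y → Tr-cong x≈y , Δ-cong x≈y)
      (λ {x} {y} _ _ (Trx≈Try , Δx≈Δy) →
        trans (sym (unsplit-Tr-Δ x)) (trans (*-congˡ (+-cong Trx≈Try (-‿cong Δx≈Δy))) (unsplit-Tr-Δ y)))
      (λ {x} _ → ∈-cartesianProduct⁺ setoid setoid
        (∈-filter⁺ setoid Δ≈0? Δ≈0-resp (complete _) (Δ-Tr x))
        (∈-filter⁺ setoid Tr≈0? Tr≈0-resp (complete _) (Tr-Δ x)))
      (λ {(u , v)} uv∈ →
        let u∈ , v∈ = ∈-cartesianProduct⁻ setoid setoid kerΔ kerTr uv∈
        in unsplit u v , complete _ ,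
           sym (Tr-unsplit (in-kerΔ u∈) (in-kerTr v∈)) , sym (Δ-unsplit (in-kerΔ u∈) (in-kerTr v∈)))
      distinct
      (Unique.cartesianProduct⁺ setoid setoid
        (Unique.filter⁺ setoid Δ≈0? distinct) (Unique.filter⁺ setoid Tr≈0? distinct))

  count-Δ≈0 : count Δ≈0? ≡ q
  count-Δ≈0 = m*o≡n*n⇒m≡n count-Δ≈0≤q count-Tr≈0≤q count-Δ≈0*count-Tr≈0

  count-Tr≈0 : count Tr≈0? ≡ q
  count-Tr≈0 = m*o≡n*n⇒m≡n count-Tr≈0≤q count-Δ≈0≤q
    (≡.trans (ℕ.*-comm (count Tr≈0?) (count Δ≈0?)) count-Δ≈0*count-Tr≈0)

  frob-fixes⇒Δ≈0 : ∀ {u} → frob u ≈ u → Δ u ≈ 0#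
  frob-fixes⇒Δ≈0 {u} frob-u≈u = trans (+-congʳ frob-u≈u) (-‿inverseʳ u)

  count-nonzero-Δ≈0 : count (λ x → Δ≈0? x ×-dec ¬? (x ≟ 0#)) ≡ q ∸ 1
  count-nonzero-Δ≈0 = ≡.trans (count-∖0 Δ≈0? Δ≈0-resp Δ-0#) (≡.cong (_∸ 1) count-Δ≈0)

  count-nonzero-Tr≈0 : count (λ x → Tr≈0? x ×-dec ¬? (x ≟ 0#)) ≡ q ∸ 1
  count-nonzero-Tr≈0 = ≡.trans (count-∖0 Tr≈0? Tr≈0-resp Tr-0#) (≡.cong (_∸ 1) count-Tr≈0)

  module FunctionalGraph {n : ℕ} (3≤n : 3 ≤ n) (n-odd : n % 2 ≡ 1)
                         {a c : Carrier} (frob-a : frob a ≈ a) (a≉0 : a ≉ 0#) (a≈c : a ≈ c) where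

    f : Carrier → Carrier
    f X = (c * pow X q + a * X) * pow (pow X q - X) (n ∸ 1)

    f-cong : ∀ {x y} → x ≈ y → f x ≈ f y
    f-cong x≈y = *-cong (+-cong (*-congˡ (frob-cong x≈y)) (*-congˡ x≈y)) (pow-cong (n ∸ 1) (Δ-cong x≈y))

    1≤n∸1 : 1 ≤ n ∸ 1
    1≤n∸1 = ℕ.≤-trans (s≤s z≤n) (ℕ.∸-monoˡ-≤ 1 3≤n)

    frob-pow-[n∸1] : ∀ {d} → Tr d ≈ 0# → frob (pow d (n ∸ 1)) ≈ pow d (n ∸ 1)
    frob-pow-[n∸1] {d} Trd≈0 = begin
      frob (pow d (n ∸ 1))          ≈⟨ frob-pow d (n ∸ 1) ⟩
      pow (frob d) (n ∸ 1)          ≈⟨ pow-cong (n ∸ 1) (Tr≈0⇒frob-negates Trd≈0) ⟩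
      pow (- d) (n ∸ 1)             ≡⟨ ≡.cong (pow (- d)) n∸1≡[n/2]*2 ⟩
      pow (- d) (n / 2 ℕ.* 2)       ≈⟨ pow-neg-even d (n / 2) ⟩
      pow d (n / 2 ℕ.* 2)           ≡⟨ ≡.cong (pow d) n∸1≡[n/2]*2 ⟨
      pow d (n ∸ 1)                 ∎
      where
      n∸1≡[n/2]*2 = odd⇒n∸1≡[n/2]*2 n n-odd

    weight : Carrier → Carrier
    weight d = a * pow d (n ∸ 1)

    f≈Tr*weight∘Δ : ∀ x → f x ≈ Tr x * weight (Δ x)
    f≈Tr*weight∘Δ x = begin
      (c * frob x + a * x) * pow (Δ x) (n ∸ 1)     ≈⟨ *-congʳ (+-congʳ (*-congʳ a≈c)) ⟨
      (a * frob x + a * x) * pow (Δ x) (n ∸ 1)     ≈⟨ *-congʳ (distribˡ a (frob x) x) ⟨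
      a * Tr x * pow (Δ x) (n ∸ 1)
        ≈⟨ solve 3 (λ a t w → a :* t :* w := t :* (a :* w)) refl a (Tr x) _ ⟩
      Tr x * weight (Δ x)                          ∎

    weight-nonzero : ∀ {d} → d ≉ 0# → weight d ≉ 0#
    weight-nonzero d≉0 = *-nonzero a≉0 (pow-nonzero (n ∸ 1) d≉0)

    frob-weight : ∀ {d} → Tr d ≈ 0# → frob (weight d) ≈ weight d
    frob-weight Trd≈0 = trans (frob-* a _) (*-cong frob-a (frob-pow-[n∸1] Trd≈0))

    Δ-f : ∀ x → Δ (f x) ≈ 0#
    Δ-f x = frob-fixes⇒Δ≈0 (begin
      frob (f x)                           ≈⟨ frob-cong (f≈Tr*weight∘Δ x) ⟩
      frob (Tr x * weight (Δ x))           ≈⟨ frob-* (Tr x) _ ⟩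
      frob (Tr x) * frob (weight (Δ x))    ≈⟨ *-cong (Δ≈0⇒frob-fixes (Δ-Tr x)) (frob-weight (Tr-Δ x)) ⟩
      Tr x * weight (Δ x)                  ≈⟨ f≈Tr*weight∘Δ x ⟨
      f x                                  ∎)

    Tr≈0⇒f≈0 : ∀ {x} → Tr x ≈ 0# → f x ≈ 0#
    Tr≈0⇒f≈0 {x} Trx≈0 = trans (f≈Tr*weight∘Δ x) (trans (*-congʳ Trx≈0) (zeroˡ _))

    Δ≈0⇒f≈0 : ∀ {x} → Δ x ≈ 0# → f x ≈ 0#
    Δ≈0⇒f≈0 {x} Δx≈0 = begin
      f x                            ≈⟨ f≈Tr*weight∘Δ x ⟩
      Tr x * (a * pow (Δ x) (n ∸ 1)) ≈⟨ *-congˡ (*-congˡ (trans (pow-cong (n ∸ 1) Δx≈0) (pow-0# 1≤n∸1))) ⟩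
      Tr x * (a * 0#)                ≈⟨ trans (*-congˡ (zeroʳ a)) (zeroʳ _) ⟩
      0#                             ∎

    f≈0⇒Tr≈0⊎Δ≈0 : ∀ {x} → f x ≈ 0# → Tr x ≈ 0# ⊎ Δ x ≈ 0#
    f≈0⇒Tr≈0⊎Δ≈0 {x} fx≈0 with x*y≈0⇒x≈0⊎y≈0 (trans (sym (f≈Tr*weight∘Δ x)) fx≈0)
    ... | inj₁ Trx≈0 = inj₁ Trx≈0
    ... | inj₂ weight≈0 with Δ x ≟ 0#
    ...   | yes Δx≈0 = inj₂ Δx≈0
    ...   | no Δx≉0  = ⊥-elim (weight-nonzero Δx≉0 weight≈0)

    f-0# : f 0# ≈ 0#
    f-0# = Δ≈0⇒f≈0 Δ-0#

    f∘f≈0 : ∀ x → f (f x) ≈ 0#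
    f∘f≈0 x = Δ≈0⇒f≈0 (Δ-f x)

    connected : ∀ x y → SameComponent f x y
    connected x y = EqClosure.transitive _ (to-0# x) (EqClosure.symmetric _ (to-0# y))
      where
      to-0# : ∀ x → SameComponent f x 0#
      to-0# x = EqClosure.transitive _ (EqClosure.return refl) (EqClosure.return (f∘f≈0 x))

    periodic⇒≈0 : ∀ x m → 1 ≤ m → iter f m x ≈ x → x ≈ 0#
    periodic⇒≈0 x (suc zero)    _ fx≈x    = trans (sym fx≈x) (Δ≈0⇒f≈0 (trans (Δ-cong (sym fx≈x)) (Δ-f x)))
    periodic⇒≈0 x (suc (suc m)) _ fᵐ⁺²x≈x = trans (sym fᵐ⁺²x≈x) (f∘f≈0 (iter f m x))

    count-nonzero-zeros : count (λ x → (f x ≟ 0#) ×-dec ¬? (x ≟ 0#)) ≡ 2 ℕ.* q ∸ 2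
    count-nonzero-zeros =
      ≡.trans (count-cong _ (λ x → Δ∖0? x ⊎-dec Tr∖0? x) split join)
      (≡.trans (count-⊎ Δ∖0? Tr∖0? (λ (Δx≈0 , x≉0) (Trx≈0 , _) → x≉0 (Δ≈0⇒Tr≈0⇒≈0 Δx≈0 Trx≈0)))
      (≡.trans (≡.cong₂ ℕ._+_ count-nonzero-Δ≈0 count-nonzero-Tr≈0) ([m∸1]+[m∸1]≡2m∸2 q)))
      where
      Δ∖0? = λ x → Δ≈0? x ×-dec ¬? (x ≟ 0#)
      Tr∖0? = λ x → Tr≈0? x ×-dec ¬? (x ≟ 0#)
      split : ∀ {x} → f x ≈ 0# × x ≉ 0# → (Δ x ≈ 0# × x ≉ 0#) ⊎ (Tr x ≈ 0# × x ≉ 0#)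
      split (fx≈0 , x≉0) with f≈0⇒Tr≈0⊎Δ≈0 fx≈0
      ... | inj₁ Trx≈0 = inj₂ (Trx≈0 , x≉0)
      ... | inj₂ Δx≈0  = inj₁ (Δx≈0 , x≉0)
      join : ∀ {x} → (Δ x ≈ 0# × x ≉ 0#) ⊎ (Tr x ≈ 0# × x ≉ 0#) → f x ≈ 0# × x ≉ 0#
      join (inj₁ (Δx≈0 , x≉0))  = Δ≈0⇒f≈0 Δx≈0 , x≉0
      join (inj₂ (Trx≈0 , x≉0)) = Tr≈0⇒f≈0 Trx≈0 , x≉0

    Δ-nonzero-on-preimage : ∀ {x y} → y ≉ 0# → f x ≈ y → Δ x ≉ 0#
    Δ-nonzero-on-preimage y≉0 fx≈y Δx≈0 = y≉0 (trans (sym fx≈y) (Δ≈0⇒f≈0 Δx≈0))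

    Δ-injective-on-preimage : ∀ {x x′ y} → y ≉ 0# → f x ≈ y → f x′ ≈ y → Δ x ≈ Δ x′ → x ≈ x′
    Δ-injective-on-preimage {x} {x′} y≉0 fx≈y fx′≈y Δx≈Δx′ = begin
      x                            ≈⟨ unsplit-Tr-Δ x ⟨
      half * (Tr x - Δ x)          ≈⟨ *-congˡ (+-cong Trx≈Trx′ (-‿cong Δx≈Δx′)) ⟩
      half * (Tr x′ - Δ x′)        ≈⟨ unsplit-Tr-Δ x′ ⟩
      x′                           ∎
      where
      Trx≈Trx′ : Tr x ≈ Tr x′
      Trx≈Trx′ = *-cancelˡ (weight-nonzero (Δ-nonzero-on-preimage y≉0 fx≈y)) (begin
        weight (Δ x) * Tr x        ≈⟨ *-comm _ _ ⟩
        Tr x * weight (Δ x)        ≈⟨ f≈Tr*weight∘Δ x ⟨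
        f x                        ≈⟨ trans fx≈y (sym fx′≈y) ⟩
        f x′                       ≈⟨ f≈Tr*weight∘Δ x′ ⟩
        Tr x′ * weight (Δ x′)      ≈⟨ *-congˡ (*-congˡ (pow-cong (n ∸ 1) Δx≈Δx′)) ⟨
        Tr x′ * weight (Δ x)       ≈⟨ *-comm _ _ ⟩
        weight (Δ x) * Tr x′       ∎)

    -- Tr x is forced to be y / weight d, and x = unsplit (Tr x) (Δ x).
    Δ-surjective-on-preimage : ∀ {y d} → Δ y ≈ 0# → Tr d ≈ 0# → d ≉ 0# → ∃ λ x → f x ≈ y × d ≈ Δ x
    Δ-surjective-on-preimage {y} {d} Δy≈0 Trd≈0 d≉0 = unsplit t d , f-unsplit , sym (Δ-unsplit Δt≈0 Trd≈0)
      where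
      t = y * weight d ⁻¹
      Δt≈0 : Δ t ≈ 0#
      Δt≈0 = frob-fixes⇒Δ≈0 (trans (frob-* y _)
        (*-cong (Δ≈0⇒frob-fixes Δy≈0) (frob-fixes-⁻¹ (weight-nonzero d≉0) (frob-weight Trd≈0))))
      f-unsplit : f (unsplit t d) ≈ y
      f-unsplit = begin
        f (unsplit t d)
          ≈⟨ f≈Tr*weight∘Δ (unsplit t d) ⟩
        Tr (unsplit t d) * weight (Δ (unsplit t d))
          ≈⟨ *-cong (Tr-unsplit Δt≈0 Trd≈0) (*-congˡ (pow-cong (n ∸ 1) (Δ-unsplit Δt≈0 Trd≈0))) ⟩
        y * weight d ⁻¹ * weight d
          ≈⟨ *-assoc y _ _ ⟩
        y * (weight d ⁻¹ * weight d)
          ≈⟨ *-congˡ (trans (*-comm _ _) (⁻¹-inverseʳ (weight-nonzero d≉0))) ⟩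
        y * 1#
          ≈⟨ *-identityʳ y ⟩
        y ∎

    count-preimage : ∀ {y} → Δ y ≈ 0# → y ≉ 0# → count (λ x → f x ≟ y) ≡ q ∸ 1
    count-preimage {y} Δy≈0 y≉0 = ≡.trans
      (count-↔ (λ x → f x ≟ y) (λ d → Tr≈0? d ×-dec ¬? (d ≟ 0#))
        (λ x≈x′ fx≈y → trans (f-cong (sym x≈x′)) fx≈y)
        (λ d≈d′ (Trd≈0 , d≉0) → Tr≈0-resp d≈d′ Trd≈0 , ≉0-resp d≈d′ d≉0)
        Δ Δ-cong (λ {x} fx≈y → Tr-Δ x , Δ-nonzero-on-preimage y≉0 fx≈y)
        (Δ-injective-on-preimage y≉0)
        (λ (Trd≈0 , d≉0) → Δ-surjective-on-preimage Δy≈0 Trd≈0 d≉0))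
      count-nonzero-Tr≈0

    count-zeros-with-q∸1-preimages :
      count (λ x → ((f x ≟ 0#) ×-dec ¬? (x ≟ 0#)) ×-dec (count (λ y → f y ≟ x) ≟ℕ q ∸ 1)) ≡ q ∸ 1
    count-zeros-with-q∸1-preimages =
      ≡.trans (count-cong _ (λ x → Δ≈0? x ×-dec ¬? (x ≟ 0#)) to from) count-nonzero-Δ≈0
      where
      to : ∀ {x} → (f x ≈ 0# × x ≉ 0#) × count (λ y → f y ≟ x) ≡ q ∸ 1 → Δ x ≈ 0# × x ≉ 0#
      to {x} ((_ , x≉0) , count≡q∸1) with Δ x ≟ 0#
      ... | yes Δx≈0 = Δx≈0 , x≉0
      ... | no Δx≉0  = ⊥-elim (ℕ.<⇒≢ (ℕ.∸-monoˡ-≤ 1 2≤q) (≡.trans (≡.sym no-preimage) count≡q∸1))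
        where
        no-preimage : count (λ y → f y ≟ x) ≡ 0
        no-preimage = count-none _ λ y fy≈x → Δx≉0 (trans (Δ-cong (sym fy≈x)) (Δ-f y))
      from : ∀ {x} → Δ x ≈ 0# × x ≉ 0# → (f x ≈ 0# × x ≉ 0#) × count (λ y → f y ≟ x) ≡ q ∸ 1
      from (Δx≈0 , x≉0) = (Δ≈0⇒f≈0 Δx≈0 , x≉0) , count-preimage Δx≈0 x≉0

mainTheorem6 : (p k : ℕ) → Prime p → p % 2 ≡ 1 → 1 ≤ k →
    (n : ℕ) → 3 ≤ n → n % 2 ≡ 1 →
    (F : FiniteField ((p ^ k) ℕ.* (p ^ k))) →
    let open FiniteField F
        q = p ^ k
    in (a c : Carrier) → pow a q ≈ a → pow c q ≈ c → ¬ (a ≈ 0# × c ≈ 0#) →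
    a - c ≈ 0# →
    let f : Carrier → Carrier
        f X = (c * pow X q + a * X) * pow (pow X q - X) (n ∸ 1)
    in (∀ x y → SameComponent f x y)
       × f 0# ≈ 0#
       × (∀ x m → 1 ≤ m → iter f m x ≈ x → x ≈ 0#)
       × count (λ x → (f x ≟ 0#) ×-dec ¬? (x ≟ 0#)) ≡ 2 ℕ.* q ∸ 2
       × count (λ x → ((f x ≟ 0#) ×-dec ¬? (x ≟ 0#))
                      ×-dec (count (λ y → f y ≟ x) ≟ℕ q ∸ 1)) ≡ q ∸ 1
-- The hypothesis pow c q ≈ c is redundant: c ≈ a.
mainTheorem6 p k p-prime p-odd 1≤k n 3≤n n-odd F a c frob-a _ a≉0∨c≉0 a-c≈0 =
  connected , f-0# , periodic⇒≈0 , count-nonzero-zeros , count-zeros-with-q∸1-preimages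
  where
  open FiniteField F
  open import Algebra.Properties.Group +-group using (x∙y⁻¹≈ε⇒x≈y)
  a≈c : a ≈ c
  a≈c = x∙y⁻¹≈ε⇒x≈y a c a-c≈0
  open FieldOfOrderSquare p-prime p-odd 1≤k F
  a≉0 : a ≉ 0#
  a≉0 a≈0 = a≉0∨c≉0 (a≈0 , trans (sym a≈c) a≈0)
  open FunctionalGraph 3≤n n-odd frob-a a≉0 a≈c
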